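{- Let $(Q,+,\cdot,\le)$ be an ordered field and $n\ge 2$, and assume $n=2$ or that $(Q,+,\cdot,\le)$ is a Euclidean field. Let $\rho\in\{\tau,\sigma\}$. If a binary relation $R$ on $Q^n$ is definable in $(Q^n,\rho)$ by an existential formula with 2 quantifiers or by a universal formula with 2 quantifiers, then $R$ is definable in $(Q^n,\rho)$ by a quantifier-free formula; that is, $R$ is one of the 8 relations obtained from $\rho$ and $=$ by Boolean operations (intersection, union, complement relative to $Q^n\times Q^n$).
   Context: For $p=(p_0,\dots,p_{n-1}),\,q=(q_0,\dots,q_{n-1})\in Q^n$: $p\,\tau\,q$ iff $(p_0-q_0)^2>\sum_{i=1}^{n-1}(p_i-q_i)^2$; $p\,\sigma\,q$ iff $(p_0-q_0)^2<\sum_{i=1}^{n-1}(p_i-q_i)^2$. An ordered field is Euclidean if every nonnegative element is a square. An existential (universal) formula with 2 quantifiers is one of the form $\exists z_1\exists z_2\,\psi(p,q,z_1,z_2)$ (resp. $\forall z_1\forall z_2\,\psi$) with $\psi$ quantifier-free in the language with equality and one binary relation symbol interpreted as $\rho$; definitions are without parameters. -}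

module Defs where

open import Data.Nat using (ℕ; zero; suc)
open import Data.Fin using (Fin) renaming (zero to fz; suc to fs)
open import Data.Vec using (Vec; []; _∷_)
open import Data.Product using (Σ; ∃; _×_; _,_)
open import Data.Sum using (_⊎_)
open import Data.Empty using (⊥)
open import Relation.Nullary using (¬_)
open import Relation.Binary.PropositionalEquality using (_≡_)
open import Algebra.Structures using (IsCommutativeRing)
open import Relation.Binary.Structures using (IsTotalOrder)
open import Function.Bundles using (_⇔_)

record OrderedField : Set₁ where
  infixl 6 _+_ _-_
  infixl 7 _*_
  infix 4 _≤_ _<_
  field
    Carrier : Set
    _+_ _*_ : Carrier → Carrier → Carrier
    -_ : Carrier → Carrier
    0# 1# : Carrier
    _≤_ : Carrier → Carrier → Set
    isCommutativeRing : IsCommutativeRing _≡_ _+_ _*_ -_ 0# 1#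
    0≢1 : ¬ (0# ≡ 1#)
    inverse : ∀ x → ¬ (x ≡ 0#) → ∃ λ y → x * y ≡ 1#
    isTotalOrder : IsTotalOrder _≡_ _≤_
    +-mono-≤ : ∀ x y z → x ≤ y → x + z ≤ y + z
    *-nonneg : ∀ x y → 0# ≤ x → 0# ≤ y → 0# ≤ x * y

  _-_ : Carrier → Carrier → Carrier
  x - y = x + (- y)

  _<_ : Carrier → Carrier → Set
  x < y = x ≤ y × ¬ (x ≡ y)

Euclidean : OrderedField → Set
Euclidean F = ∀ x → 0# ≤ x → ∃ λ y → y * y ≡ x
  where open OrderedField F

module Space (F : OrderedField) where
  open OrderedField F

  sq : Carrier → Carrier
  sq x = x * x

  sumSq : ∀ {m} → Vec Carrier m → Vec Carrier m → Carrier
  sumSq [] [] = 0#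
  sumSq (x ∷ xs) (y ∷ ys) = sq (x - y) + sumSq xs ys

  -- p τ q iff (p0-q0)^2 > Σ_{i≥1} (p_i-q_i)^2  (n = 0: empty relation, irrelevant since n ≥ 2)
  τ : ∀ {n} → Vec Carrier n → Vec Carrier n → Set
  τ [] [] = ⊥
  τ (p₀ ∷ ps) (q₀ ∷ qs) = sumSq ps qs < sq (p₀ - q₀)

  σ : ∀ {n} → Vec Carrier n → Vec Carrier n → Set
  σ [] [] = ⊥
  σ (p₀ ∷ ps) (q₀ ∷ qs) = sq (p₀ - q₀) < sumSq ps qs

data Rho : Set where
  rτ rσ : Rho

data QF (k : ℕ) : Set where
  eqA  : Fin k → Fin k → QF k
  relA : Fin k → Fin k → QF k
  neg  : QF k → QF k
  and  : QF k → QF k → QF k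
  or   : QF k → QF k → QF k

module Semantics (F : OrderedField) (n : ℕ) (ρ : Rho) where
  open OrderedField F
  open Space F

  Pt : Set
  Pt = Vec Carrier n

  relOf : Rho → Pt → Pt → Set
  relOf rτ = τ
  relOf rσ = σ

  rel : Pt → Pt → Set
  rel = relOf ρ

  ⟦_⟧ : ∀ {k} → QF k → (Fin k → Pt) → Set
  ⟦ eqA i j ⟧ e = e i ≡ e j
  ⟦ relA i j ⟧ e = rel (e i) (e j)
  ⟦ neg φ ⟧ e = ¬ ⟦ φ ⟧ e
  ⟦ and φ ψ ⟧ e = ⟦ φ ⟧ e × ⟦ ψ ⟧ e
  ⟦ or φ ψ ⟧ e = ⟦ φ ⟧ e ⊎ ⟦ ψ ⟧ e

  env2 : Pt → Pt → Fin 2 → Pt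
  env2 p q fz = p
  env2 p q (fs _) = q

  env4 : Pt → Pt → Pt → Pt → Fin 4 → Pt
  env4 p q z₁ z₂ fz = p
  env4 p q z₁ z₂ (fs fz) = q
  env4 p q z₁ z₂ (fs (fs fz)) = z₁
  env4 p q z₁ z₂ (fs (fs (fs _))) = z₂

  ExistDefinable2 : (Pt → Pt → Set) → Set
  ExistDefinable2 R = Σ (QF 4) λ ψ → ∀ p q →
    R p q ⇔ (∃ λ z₁ → ∃ λ z₂ → ⟦ ψ ⟧ (env4 p q z₁ z₂))

  UnivDefinable2 : (Pt → Pt → Set) → Set
  UnivDefinable2 R = Σ (QF 4) λ ψ → ∀ p q →
    R p q ⇔ (∀ z₁ z₂ → ⟦ ψ ⟧ (env4 p q z₁ z₂))

  QFDefinable : (Pt → Pt → Set) → Set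
  QFDefinable R = Σ (QF 2) λ φ → ∀ p q → R p q ⇔ ⟦ φ ⟧ (env2 p q)

-- A relation R defined by ∃z₁∃z₂ψ or by ∀z₁∀z₂ψ depends only on the type of the pair (p, q): whether
-- p = q, p ρ q, or neither. Hence R is a union of types and is defined by the disjunction of the
-- corresponding atomic formulas.
--
-- For invariance, given pairs (p, q), (p′, q′) of equal type and points z₁, z₂, we find z₁′, z₂′ such
-- that (p′, q′, z₁′, z₂′) has the same atomic diagram as (p, q, z₁, z₂). Make ℤ² a graph by
-- x ~ y iff (x₁ - y₁)(x₂ - y₂) > 0. For a unit vector e ∈ Qⁿ⁻¹ and a, b such that ab has the sign of ρ
-- (positive for τ, negative for σ), (u, w) ↦ o + (ua + wb, (ua - wb) e) embeds this graph into (Qⁿ, ρ).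
-- Choosing o, a, b, e suitably, (p′, q′) is the image of (0, c) for one of four points c; this needs
-- a square root of |q′ - p′|² over the last n - 1 coordinates, whence n = 2 or Q Euclidean. Finally,
-- every diagram of four points that respects equality and whose first pair has the type of (0, c) is
-- realised by (0, c, x₁, x₂) for some x₁, x₂ ∈ [-3, 3]², as checked by evaluation.

module Submission where

open import Defs
open import Level using (0ℓ)
open import Data.Nat as ℕ using (ℕ; zero; suc)
import Data.Nat.Properties as ℕ
open import Data.Integer as ℤ using (ℤ; -[1+_]; +[1+_]; 0ℤ; _⊖_; _◃_)
import Data.Integer.Properties as ℤ
open import Data.Integer.Tactic.RingSolver using (solve-∀)
open import Data.Sign as Sign using (Sign)
open import Data.Fin as Fin using (Fin)
import Data.Fin.Properties as Finₚ
open import Data.List using (List; []; _∷_; map; cartesianProduct; upTo)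
open import Data.List.Membership.Propositional using (_∈_)
open import Data.List.Relation.Unary.Any using (Any; any?; satisfied; here; there)
open import Data.List.Relation.Unary.All as All using (All)
import Data.Maybe as Maybe
open import Data.Vec using (Vec; []; _∷_; lookup; zipWith; replicate; head; tail)
open import Data.Product using (Σ; ∃; ∃₂; _×_; _,_; proj₁; proj₂; map₂)
open import Data.Product.Properties using (≡-dec)
open import Data.Product.Function.NonDependent.Propositional using (_×-⇔_)
open import Data.Sum using (_⊎_; inj₁; inj₂)
open import Data.Sum.Function.Propositional using (_⊎-⇔_)
open import Data.Empty using (⊥; ⊥-elim)
open import Data.Unit using (tt)
open import Function.Bundles using (_⇔_; mk⇔; Equivalence)
import Function.Properties.Equivalence as ⇔
open import Function.Related.TypeIsomorphisms using (¬-cong-⇔)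
open import Relation.Nullary using (Dec; yes; no; ¬_)
open import Relation.Nullary.Decidable using (toWitness; dec⇒maybe; _×-dec_; _→-dec_)
open import Relation.Binary.Definitions using (DecidableEquality; Decidable)
open import Relation.Binary.Structures using (IsTotalOrder)
open import Relation.Binary.PropositionalEquality
open import Algebra.Bundles using (CommutativeRing)
open import Algebra.Solver.Ring.AlmostCommutativeRing using (fromCommutativeRing; _-Raw-AlmostCommutative⟶_)

data PairType : Set where
  same related apart : PairType

_≟ₜ_ : DecidableEquality PairType
same    ≟ₜ same    = yes refl
related ≟ₜ related = yes refl
apart   ≟ₜ apart   = yes refl
same    ≟ₜ related = no λ ()
same    ≟ₜ apart   = no λ ()
related ≟ₜ same    = no λ ()
related ≟ₜ apart   = no λ ()
apart   ≟ₜ same    = no λ ()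
apart   ≟ₜ related = no λ ()

∀-PairType? : {P : PairType → Set} → (∀ t → Dec (P t)) → Dec (∀ t → P t)
∀-PairType? P? with P? same | P? related | P? apart
... | yes s | yes r | yes a = yes λ { same → s ; related → r ; apart → a }
... | no ¬s | _     | _     = no λ f → ¬s (f same)
... | yes _ | no ¬r | _     = no λ f → ¬r (f related)
... | yes _ | yes _ | no ¬a = no λ f → ¬a (f apart)

classify : {A B : Set} → Dec A → Dec B → PairType
classify (yes _) _       = same
classify (no _)  (yes _) = related
classify (no _)  (no _)  = apart

module _ {A B : Set} where

  classify≡same⇔ : (a? : Dec A) (b? : Dec B) → classify a? b? ≡ same ⇔ A
  classify≡same⇔ (yes a) _       = mk⇔ (λ _ → a) (λ _ → refl)
  classify≡same⇔ (no ¬a) (yes _) = mk⇔ (λ ()) (λ a → ⊥-elim (¬a a))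
  classify≡same⇔ (no ¬a) (no _)  = mk⇔ (λ ()) (λ a → ⊥-elim (¬a a))

  classify≡related⇔ : (B → ¬ A) → (a? : Dec A) (b? : Dec B) → classify a? b? ≡ related ⇔ B
  classify≡related⇔ B⇒¬A (yes a) _       = mk⇔ (λ ()) (λ b → ⊥-elim (B⇒¬A b a))
  classify≡related⇔ B⇒¬A (no _)  (yes b) = mk⇔ (λ _ → b) (λ _ → refl)
  classify≡related⇔ B⇒¬A (no _)  (no ¬b) = mk⇔ (λ ()) (λ b → ⊥-elim (¬b b))

  classify≡apart⇔ : (a? : Dec A) (b? : Dec B) → classify a? b? ≡ apart ⇔ (¬ A × ¬ B)
  classify≡apart⇔ (yes a) _       = mk⇔ (λ ()) (λ (¬a , _) → ⊥-elim (¬a a))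
  classify≡apart⇔ (no _)  (yes b) = mk⇔ (λ ()) (λ (_ , ¬b) → ⊥-elim (¬b b))
  classify≡apart⇔ (no ¬a) (no ¬b) = mk⇔ (λ _ → ¬a , ¬b) (λ _ → refl)

  classify-cong : {A′ B′ : Set} → A ⇔ A′ → B ⇔ B′ → (a? : Dec A) (b? : Dec B) (a′? : Dec A′) (b′? : Dec B′) →
                  classify a? b? ≡ classify a′? b′?
  classify-cong A⇔ B⇔ (yes _) _       (yes _)  _        = refl
  classify-cong A⇔ B⇔ (yes a) _       (no ¬a′) _        = ⊥-elim (¬a′ (Equivalence.to A⇔ a))
  classify-cong A⇔ B⇔ (no ¬a) _       (yes a′) _        = ⊥-elim (¬a (Equivalence.from A⇔ a′))
  classify-cong A⇔ B⇔ (no _)  (yes _) (no _)   (yes _)  = refl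
  classify-cong A⇔ B⇔ (no _)  (yes b) (no _)   (no ¬b′) = ⊥-elim (¬b′ (Equivalence.to B⇔ b))
  classify-cong A⇔ B⇔ (no _)  (no ¬b) (no _)   (yes b′) = ⊥-elim (¬b (Equivalence.from B⇔ b′))
  classify-cong A⇔ B⇔ (no _)  (no _)  (no _)   (no _)   = refl

Diagram : ℕ → Set
Diagram k = Fin k → Fin k → PairType

Consistent : ∀ {k} → Diagram k → Set
Consistent D = ∀ i j k → D i j ≡ same → D i k ≡ D j k

Consistent-resp : ∀ {k} {D D′ : Diagram k} → (∀ i j → D i j ≡ D′ i j) → Consistent D → Consistent D′
Consistent-resp D≗D′ consistent i j k D′ij≡same =
  trans (sym (D≗D′ i k)) (trans (consistent i j k (trans (D≗D′ i j) D′ij≡same)) (D≗D′ j k))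

consistent? : ∀ {k} (D : Diagram k) → Dec (Consistent D)
consistent? D = Finₚ.all? λ i → Finₚ.all? λ j → Finₚ.all? λ k → (D i j ≟ₜ same) →-dec (D i k ≟ₜ D j k)

pattern 0F = Fin.zero
pattern 1F = Fin.suc 0F
pattern 2F = Fin.suc 1F
pattern 3F = Fin.suc 2F

record Labels : Set where
  constructor labels
  field l01 l02 l12 l03 l13 l23 : PairType

upper : Diagram 4 → Labels
upper D = labels (D 0F 1F) (D 0F 2F) (D 1F 2F) (D 0F 3F) (D 1F 3F) (D 2F 3F)

fromLabels : Labels → Diagram 4
fromLabels (labels l01 l02 l12 l03 l13 l23) = λ where
  0F 0F → same ; 0F 1F → l01  ; 0F 2F → l02  ; 0F 3F → l03
  1F 0F → l01  ; 1F 1F → same ; 1F 2F → l12  ; 1F 3F → l13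
  2F 0F → l02  ; 2F 1F → l12  ; 2F 2F → same ; 2F 3F → l23
  3F 0F → l03  ; 3F 1F → l13  ; 3F 2F → l23  ; 3F 3F → same

fromLabels-upper : (D : Diagram 4) → (∀ i → D i i ≡ same) → (∀ i j → D i j ≡ D j i) →
                   ∀ i j → D i j ≡ fromLabels (upper D) i j
fromLabels-upper D refl-D sym-D = λ where
  0F 0F → refl-D 0F ; 0F 1F → refl ; 0F 2F → refl ; 0F 3F → refl
  1F 0F → sym-D 1F 0F ; 1F 1F → refl-D 1F ; 1F 2F → refl ; 1F 3F → refl
  2F 0F → sym-D 2F 0F ; 2F 1F → sym-D 2F 1F ; 2F 2F → refl-D 2F ; 2F 3F → refl
  3F 0F → sym-D 3F 0F ; 3F 1F → sym-D 3F 1F ; 3F 2F → sym-D 3F 2F ; 3F 3F → refl-D 3F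

record Graph : Set₁ where
  infix 4 _~_
  field
    Vertex   : Set
    _~_      : Vertex → Vertex → Set
    _≟_      : DecidableEquality Vertex
    _~?_     : Decidable _~_
    ~-irrefl : ∀ {x} → ¬ x ~ x
    ~-sym    : ∀ {x y} → x ~ y → y ~ x

  typeOf : Vertex → Vertex → PairType
  typeOf x y = classify (x ≟ y) (x ~? y)

  typeOf≡same⇔ : ∀ {x y} → typeOf x y ≡ same ⇔ x ≡ y
  typeOf≡same⇔ {x} {y} = classify≡same⇔ (x ≟ y) (x ~? y)

  typeOf≡related⇔ : ∀ {x y} → typeOf x y ≡ related ⇔ x ~ y
  typeOf≡related⇔ {x} {y} = classify≡related⇔ (λ { r refl → ~-irrefl r }) (x ≟ y) (x ~? y)

  typeOf≡apart⇔ : ∀ {x y} → typeOf x y ≡ apart ⇔ (x ≢ y × ¬ x ~ y)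
  typeOf≡apart⇔ {x} {y} = classify≡apart⇔ (x ≟ y) (x ~? y)

  typeOf-refl : ∀ x → typeOf x x ≡ same
  typeOf-refl x = Equivalence.from typeOf≡same⇔ refl

  typeOf-sym : ∀ x y → typeOf x y ≡ typeOf y x
  typeOf-sym x y = classify-cong (mk⇔ sym sym) (mk⇔ ~-sym ~-sym) (x ≟ y) (x ~? y) (y ≟ x) (y ~? x)

  diagram : ∀ {k} → (Fin k → Vertex) → Diagram k
  diagram v i j = typeOf (v i) (v j)

  diagram-consistent : ∀ {k} (v : Fin k → Vertex) → Consistent (diagram v)
  diagram-consistent v i j k vi≡vj = cong (λ x → typeOf x (v k)) (Equivalence.to typeOf≡same⇔ vi≡vj)

  diagram≗fromLabels : (v : Fin 4 → Vertex) → ∀ i j → diagram v i j ≡ fromLabels (upper (diagram v)) i j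
  diagram≗fromLabels v = fromLabels-upper (diagram v) (λ i → typeOf-refl (v i)) (λ i j → typeOf-sym (v i) (v j))

record _↪_ (G H : Graph) : Set where
  private
    module G = Graph G
    module H = Graph H
  field
    apply     : G.Vertex → H.Vertex
    injective : ∀ {x y} → apply x ≡ apply y → x ≡ y
    ~-reflect : ∀ {x y} → apply x H.~ apply y ⇔ x G.~ y

  typeOf-apply : ∀ x y → H.typeOf (apply x) (apply y) ≡ G.typeOf x y
  typeOf-apply x y = classify-cong (mk⇔ injective (cong apply)) ~-reflect
    (apply x H.≟ apply y) (apply x H.~? apply y) (x G.≟ y) (x G.~? y)

quad : {A : Set} → A → A → A → A → Fin 4 → A
quad a b c d = lookup (a ∷ b ∷ c ∷ d ∷ [])

Point : Set
Point = ℤ × ℤ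

diffProduct : Point → Point → ℤ
diffProduct (u , w) (u′ , w′) = (u ℤ.- u′) ℤ.* (w ℤ.- w′)

diffProduct-sym : ∀ x y → diffProduct x y ≡ diffProduct y x
diffProduct-sym (u , w) (u′ , w′) = swap u w u′ w′
  where
  swap : ∀ u w u′ w′ → (u ℤ.- u′) ℤ.* (w ℤ.- w′) ≡ (u′ ℤ.- u) ℤ.* (w′ ℤ.- w)
  swap = solve-∀

diffProduct-self : ∀ x → diffProduct x x ≡ 0ℤ
diffProduct-self (u , w) = cong (ℤ._* (w ℤ.- w)) (ℤ.+-inverseʳ u)

comparability : Graph
comparability = record
  { Vertex   = Point
  ; _~_      = λ x y → 0ℤ ℤ.< diffProduct x y
  ; _≟_      = ≡-dec ℤ._≟_ ℤ._≟_
  ; _~?_     = λ x y → 0ℤ ℤ.<? diffProduct x y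
  ; ~-irrefl = λ {x} → ℤ.<-irrefl (sym (diffProduct-self x))
  ; ~-sym    = λ {x} {y} → subst (0ℤ ℤ.<_) (diffProduct-sym x y)
  }

open Graph comparability using () renaming (typeOf to typeℤ²; diagram to diagramℤ²)

origin : Point
origin = 0ℤ , 0ℤ

-- One target point for each case of every-pair-hit below: equal, ρ-related, light-like, and the other pairs.
canonical : List Point
canonical = origin ∷ (ℤ.+ 2 , ℤ.+ 2) ∷ (ℤ.+ 2 , 0ℤ) ∷ (ℤ.+ 2 , ℤ.- ℤ.+ 2) ∷ []

grid : List Point
grid = cartesianProduct window window
  where window = map (λ k → ℤ.+ k ℤ.- ℤ.+ 3) (upTo 7)

Extendable : Point → Set
Extendable q = ∀ L → Labels.l01 L ≡ typeℤ² origin q → Consistent (fromLabels L) →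
               ∃₂ λ x₁ x₂ → upper (diagramℤ² (quad origin q x₁ x₂)) ≡ L

module _ (q : Point) (L : Labels) where
  open Labels L

  ExtendableInGrid : Set
  ExtendableInGrid = Any (λ x₁ → typeℤ² origin x₁ ≡ l02 × typeℤ² q x₁ ≡ l12 ×
    Any (λ x₂ → typeℤ² origin x₂ ≡ l03 × typeℤ² q x₂ ≡ l13 × typeℤ² x₁ x₂ ≡ l23) grid) grid

  extendableInGrid? : Dec ExtendableInGrid
  extendableInGrid? = any? (λ x₁ → typeℤ² origin x₁ ≟ₜ l02 ×-dec typeℤ² q x₁ ≟ₜ l12 ×-dec
    any? (λ x₂ → typeℤ² origin x₂ ≟ₜ l03 ×-dec typeℤ² q x₂ ≟ₜ l13 ×-dec typeℤ² x₁ x₂ ≟ₜ l23) grid) grid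

extendableInGrid⇒ : ∀ q L → Labels.l01 L ≡ typeℤ² origin q → ExtendableInGrid q L →
                    ∃₂ λ x₁ x₂ → upper (diagramℤ² (quad origin q x₁ x₂)) ≡ L
extendableInGrid⇒ q (labels _ _ _ _ _ _) refl found with satisfied found
... | x₁ , refl , refl , found₂ with satisfied found₂
...   | x₂ , refl , refl , refl = x₁ , x₂ , refl

abstract
  -- Checked by evaluation. Kept abstract, since unfolding the certificate where it is used exhausts memory.
  canonical-extendable : All Extendable canonical
  canonical-extendable = All.map (λ {q} h (labels l01 l02 l12 l03 l13 l23) l01≡ consistent →
      extendableInGrid⇒ q _ l01≡ (h l01 l02 l12 l03 l13 l23 l01≡ consistent))
    (toWitness {a? = All.all? extendable? canonical} tt)
    where
    extendable? : ∀ q → Dec (∀ l01 l02 l12 l03 l13 l23 → let L = labels l01 l02 l12 l03 l13 l23 in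
                    l01 ≡ typeℤ² origin q → Consistent (fromLabels L) → ExtendableInGrid q L)
    extendable? q = ∀-PairType? λ l01 → ∀-PairType? λ l02 → ∀-PairType? λ l12 →
      ∀-PairType? λ l03 → ∀-PairType? λ l13 → ∀-PairType? λ l23 →
      let L = labels l01 l02 l12 l03 l13 l23 in
      (l01 ≟ₜ typeℤ² origin q) →-dec consistent? (fromLabels L) →-dec extendableInGrid? q L

module OrderedFieldProperties (F : OrderedField) where
  open OrderedField F public
  open IsTotalOrder isTotalOrder public using (total; antisym) renaming (refl to ≤-refl; trans to ≤-trans)

  commutativeRing : CommutativeRing 0ℓ 0ℓ
  commutativeRing = record { isCommutativeRing = isCommutativeRing }

  open CommutativeRing commutativeRing public
    using (+-assoc; +-comm; +-identityˡ; +-identityʳ; -‿inverseʳ; -‿inverseˡ;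
           *-identityˡ; *-identityʳ; zeroˡ; zeroʳ; ring; semiring)
  open import Algebra.Properties.Ring ring public
    using (-0#≈0#; -‿involutive; -‿distribˡ-*; -‿distribʳ-*; -‿anti-homo-+)
  open import Algebra.Properties.Semiring.Mult semiring using (×-homo-+; ×1-homo-*) renaming (_×_ to _·_)

  ι : ℤ → Carrier
  ι (ℤ.+ n)    = n · 1#
  ι -[1+ n ] = - (suc n · 1#)

  private
    signed : Sign → Carrier → Carrier
    signed Sign.+ x = x
    signed Sign.- x = - x

    ι-◃ : ∀ s n → ι (s ◃ n) ≡ signed s (n · 1#)
    ι-◃ Sign.+ zero    = refl
    ι-◃ Sign.- zero    = sym -0#≈0#
    ι-◃ Sign.+ (suc n) = refl
    ι-◃ Sign.- (suc n) = refl

    ι≡signed : ∀ i → ι i ≡ signed (ℤ.sign i) (ℤ.∣ i ∣ · 1#)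
    ι≡signed (ℤ.+ n)    = refl
    ι≡signed -[1+ n ] = refl

    signed-* : ∀ s t x y → signed (s Sign.* t) (x * y) ≡ signed s x * signed t y
    signed-* Sign.+ Sign.+ x y = refl
    signed-* Sign.+ Sign.- x y = -‿distribʳ-* x y
    signed-* Sign.- Sign.+ x y = -‿distribˡ-* x y
    signed-* Sign.- Sign.- x y = begin
      x * y           ≡⟨ -‿involutive (x * y) ⟨
      - (- (x * y))   ≡⟨ cong -_ (-‿distribˡ-* x y) ⟩
      - (- x * y)     ≡⟨ -‿distribʳ-* (- x) y ⟩
      - x * - y       ∎
      where open ≡-Reasoning

    +-cancelˡ-sub : ∀ z x y → (z + x) - (z + y) ≡ x - y
    +-cancelˡ-sub z x y = begin
      (z + x) + - (z + y)   ≡⟨ cong ((z + x) +_) (-‿anti-homo-+ z y) ⟩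
      (z + x) + (- y + - z) ≡⟨ cong (_+ (- y + - z)) (+-comm z x) ⟩
      (x + z) + (- y + - z) ≡⟨ +-assoc x z _ ⟩
      x + (z + (- y + - z)) ≡⟨ cong (x +_) (+-comm z _) ⟩
      x + ((- y + - z) + z) ≡⟨ cong (x +_) (+-assoc (- y) (- z) z) ⟩
      x + (- y + (- z + z)) ≡⟨ cong (λ t → x + (- y + t)) (-‿inverseˡ z) ⟩
      x + (- y + 0#)        ≡⟨ cong (x +_) (+-identityʳ (- y)) ⟩
      x - y                 ∎
      where open ≡-Reasoning

    ι-⊖ : ∀ m n → ι (m ⊖ n) ≡ m · 1# - n · 1#
    ι-⊖ zero    zero    = sym (-‿inverseʳ 0#)
    ι-⊖ zero    (suc n) = sym (+-identityˡ _)
    ι-⊖ (suc m) zero    = sym (trans (cong (suc m · 1# +_) -0#≈0#) (+-identityʳ _))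
    ι-⊖ (suc m) (suc n) = begin
      ι (suc m ⊖ suc n)          ≡⟨ cong ι (ℤ.[1+m]⊖[1+n]≡m⊖n m n) ⟩
      ι (m ⊖ n)                  ≡⟨ ι-⊖ m n ⟩
      m · 1# - n · 1#            ≡⟨ +-cancelˡ-sub 1# (m · 1#) (n · 1#) ⟨
      suc m · 1# - suc n · 1#    ∎
      where open ≡-Reasoning

  ι-+ : ∀ i j → ι (i ℤ.+ j) ≡ ι i + ι j
  ι-+ (ℤ.+ m)    (ℤ.+ n)    = ×-homo-+ 1# m n
  ι-+ (ℤ.+ m)    -[1+ n ] = ι-⊖ m (suc n)
  ι-+ -[1+ m ] (ℤ.+ n)    = trans (ι-⊖ n (suc m)) (+-comm _ _)
  ι-+ -[1+ m ] -[1+ n ] = begin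
    - (suc (suc (m ℕ.+ n)) · 1#)                ≡⟨ cong (λ k → - (suc k · 1#)) (ℕ.+-suc m n) ⟨
    - ((suc m ℕ.+ suc n) · 1#)                  ≡⟨ cong -_ (×-homo-+ 1# (suc m) (suc n)) ⟩
    - (suc m · 1# + suc n · 1#)                 ≡⟨ -‿anti-homo-+ _ _ ⟩
    - (suc n · 1#) + - (suc m · 1#)             ≡⟨ +-comm _ _ ⟩
    - (suc m · 1#) + - (suc n · 1#)             ∎
    where open ≡-Reasoning

  ι-* : ∀ i j → ι (i ℤ.* j) ≡ ι i * ι j
  ι-* i j = begin
    ι (s ◃ (ℤ.∣ i ∣ ℕ.* ℤ.∣ j ∣))                     ≡⟨ ι-◃ s (ℤ.∣ i ∣ ℕ.* ℤ.∣ j ∣) ⟩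
    signed s ((ℤ.∣ i ∣ ℕ.* ℤ.∣ j ∣) · 1#)             ≡⟨ cong (signed s) (×1-homo-* ℤ.∣ i ∣ ℤ.∣ j ∣) ⟩
    signed s (ℤ.∣ i ∣ · 1# * ℤ.∣ j ∣ · 1#)            ≡⟨ signed-* (ℤ.sign i) (ℤ.sign j) _ _ ⟩
    signed (ℤ.sign i) (ℤ.∣ i ∣ · 1#) * signed (ℤ.sign j) (ℤ.∣ j ∣ · 1#) ≡⟨ cong₂ _*_ (ι≡signed i) (ι≡signed j) ⟨
    ι i * ι j                                          ∎
    where
    open ≡-Reasoning
    s = ℤ.sign i Sign.* ℤ.sign j

  ι-neg : ∀ i → ι (ℤ.- i) ≡ - ι i
  ι-neg (ℤ.+ zero)  = sym -0#≈0#
  ι-neg +[1+ n ]  = refl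
  ι-neg -[1+ n ]  = sym (-‿involutive _)

  ι-sub : ∀ i j → ι (i ℤ.- j) ≡ ι i - ι j
  ι-sub i j = trans (ι-+ i (ℤ.- j)) (cong (ι i +_) (ι-neg j))

  ι-homomorphism : ℤ.+-*-rawRing -Raw-AlmostCommutative⟶ fromCommutativeRing commutativeRing
  ι-homomorphism = record
    { ⟦_⟧ = ι ; +-homo = ι-+ ; *-homo = ι-* ; -‿homo = ι-neg ; 0-homo = refl ; 1-homo = +-identityʳ 1# }

  open import Algebra.Solver.Ring ℤ.+-*-rawRing (fromCommutativeRing commutativeRing) ι-homomorphism
    (λ i j → Maybe.map (cong ι) (dec⇒maybe (i ℤ.≟ j))) public
    using (solve; _:=_; _:+_; _:*_; :-_; _:-_; con)

  ≤⇒0≤- : ∀ {x y} → x ≤ y → 0# ≤ y - x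
  ≤⇒0≤- {x} {y} x≤y = subst (_≤ y - x) (-‿inverseʳ x) (+-mono-≤ x y (- x) x≤y)

  0≤-⇒≤ : ∀ {x y} → 0# ≤ y - x → x ≤ y
  0≤-⇒≤ {x} {y} 0≤y-x = subst₂ _≤_ (+-identityˡ x) (solve 2 (λ x y → (y :- x) :+ x := y) refl x y)
    (+-mono-≤ 0# (y - x) x 0≤y-x)

  -≡0⇒≡ : ∀ {x y} → y - x ≡ 0# → y ≡ x
  -≡0⇒≡ {x} {y} y-x≡0 = begin
    y             ≡⟨ solve 2 (λ x y → y := (y :- x) :+ x) refl x y ⟩
    (y - x) + x   ≡⟨ cong (_+ x) y-x≡0 ⟩
    0# + x        ≡⟨ +-identityˡ x ⟩
    x             ∎
    where open ≡-Reasoning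

  <⇔0<- : ∀ {x y} → x < y ⇔ 0# < y - x
  <⇔0<- {x} {y} = mk⇔
    (λ (x≤y , x≢y) → ≤⇒0≤- x≤y , λ 0≡y-x → x≢y (sym (-≡0⇒≡ (sym 0≡y-x))))
    (λ (0≤y-x , 0≢y-x) → 0≤-⇒≤ 0≤y-x , λ { refl → 0≢y-x (sym (-‿inverseʳ x)) })

  -‿nonneg : ∀ {x} → x ≤ 0# → 0# ≤ - x
  -‿nonneg {x} x≤0 = subst (0# ≤_) (+-identityˡ (- x)) (≤⇒0≤- x≤0)

  -‿nonpos : ∀ {x} → 0# ≤ x → - x ≤ 0#
  -‿nonpos {x} 0≤x = 0≤-⇒≤ (subst (0# ≤_) (solve 1 (λ x → x := con (ℤ.+ 0) :- (:- x)) refl x) 0≤x)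

  +-nonneg : ∀ {x y} → 0# ≤ x → 0# ≤ y → 0# ≤ x + y
  +-nonneg {x} {y} 0≤x 0≤y = ≤-trans (subst (_≤ x + 0#) (+-identityʳ 0#) (+-mono-≤ 0# x 0# 0≤x))
    (subst₂ _≤_ (+-comm 0# x) (+-comm y x) (+-mono-≤ 0# y x 0≤y))

  +-nonneg-≡0 : ∀ {x y} → 0# ≤ x → 0# ≤ y → x + y ≡ 0# → x ≡ 0#
  +-nonneg-≡0 {x} {y} 0≤x 0≤y x+y≡0 =
    antisym (subst₂ _≤_ (+-identityʳ x) x+y≡0 (subst₂ _≤_ (+-comm 0# x) (+-comm y x) (+-mono-≤ 0# y x 0≤y))) 0≤x

  0≤x*x : ∀ x → 0# ≤ x * x
  0≤x*x x with total 0# x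
  ... | inj₁ 0≤x = *-nonneg x x 0≤x 0≤x
  ... | inj₂ x≤0 = subst (0# ≤_) (solve 1 (λ x → (:- x) :* (:- x) := x :* x) refl x)
                     (*-nonneg (- x) (- x) (-‿nonneg x≤0) (-‿nonneg x≤0))

  0<1 : 0# < 1#
  0<1 = subst (0# ≤_) (*-identityˡ 1#) (0≤x*x 1#) , 0≢1

  *-cancel-≡0 : ∀ {x y} → x ≢ 0# → x * y ≡ 0# → y ≡ 0#
  *-cancel-≡0 {x} {y} x≢0 xy≡0 with inverse x x≢0
  ... | x⁻¹ , xx⁻¹≡1 = begin
    y               ≡⟨ *-identityˡ y ⟨
    1# * y          ≡⟨ cong (_* y) xx⁻¹≡1 ⟨
    (x * x⁻¹) * y   ≡⟨ solve 3 (λ x x⁻¹ y → (x :* x⁻¹) :* y := x⁻¹ :* (x :* y)) refl x x⁻¹ y ⟩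
    x⁻¹ * (x * y)   ≡⟨ cong (x⁻¹ *_) xy≡0 ⟩
    x⁻¹ * 0#        ≡⟨ zeroʳ x⁻¹ ⟩
    0#              ∎
    where open ≡-Reasoning

  *-pos : ∀ {x y} → 0# < x → 0# < y → 0# < x * y
  *-pos {x} {y} (0≤x , 0≢x) (0≤y , 0≢y) =
    *-nonneg x y 0≤x 0≤y , λ 0≡xy → 0≢y (sym (*-cancel-≡0 (λ x≡0 → 0≢x (sym x≡0)) (sym 0≡xy)))

  0<x*x : ∀ {x} → x ≢ 0# → 0# < x * x
  0<x*x {x} x≢0 = 0≤x*x x , λ 0≡xx → x≢0 (*-cancel-≡0 x≢0 (sym 0≡xx))

  pos*-⇔ : ∀ {c x} → 0# < c → 0# < c * x ⇔ 0# < x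
  pos*-⇔ {c} {x} 0<c@(0≤c , _) = mk⇔ to (*-pos 0<c)
    where
    to : 0# < c * x → 0# < x
    to (0≤cx , 0≢cx) with total 0# x
    ... | inj₁ 0≤x = 0≤x , λ { refl → 0≢cx (sym (zeroʳ c)) }
    ... | inj₂ x≤0 = ⊥-elim (0≢cx (antisym 0≤cx cx≤0))
      where
      cx≤0 : c * x ≤ 0#
      cx≤0 = subst (_≤ 0#) (solve 2 (λ c x → :- (c :* (:- x)) := c :* x) refl c x)
               (-‿nonpos (*-nonneg c (- x) 0≤c (-‿nonneg x≤0)))

  0≮⇒0<- : ∀ {x} → ¬ 0# < x → x ≢ 0# → 0# < - x
  0≮⇒0<- {x} 0≮x x≢0 with total 0# x
  ... | inj₁ 0≤x = ⊥-elim (0≮x (0≤x , λ 0≡x → x≢0 (sym 0≡x)))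
  ... | inj₂ x≤0 = -‿nonneg x≤0 , λ 0≡-x → x≢0 (trans (sym (-‿involutive x)) (trans (cong -_ (sym 0≡-x)) -0#≈0#))

  0<1+ : ∀ {x} → 0# ≤ x → 0# < 1# + x
  0<1+ {x} 0≤x = +-nonneg (proj₁ 0<1) 0≤x , λ 0≡1+x → 0≢1 (sym (+-nonneg-≡0 (proj₁ 0<1) 0≤x (sym 0≡1+x)))

  0≤n·1 : ∀ n → 0# ≤ n · 1#
  0≤n·1 zero    = ≤-refl
  0≤n·1 (suc n) = proj₁ (0<1+ (0≤n·1 n))

  0<ι-suc : ∀ n → 0# < ι +[1+ n ]
  0<ι-suc n = 0<1+ (0≤n·1 n)

  0<ι⇔ : ∀ {i} → 0# < ι i ⇔ 0ℤ ℤ.< i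
  0<ι⇔ {ℤ.+ zero}  = mk⇔ (λ (_ , 0≢0) → ⊥-elim (0≢0 refl)) λ { (ℤ.+<+ ()) }
  0<ι⇔ {+[1+ n ]}  = mk⇔ (λ _ → ℤ.+<+ (ℕ.s≤s ℕ.z≤n)) (λ _ → 0<ι-suc n)
  0<ι⇔ { -[1+ n ]} = mk⇔ (λ (0≤-y , 0≢-y) → ⊥-elim (proj₂ (0<ι-suc n) (sym (
                           +-nonneg-≡0 (proj₁ (0<ι-suc n)) 0≤-y (-‿inverseʳ _))))) λ ()

  ι≡0⇒≡0ℤ : ∀ {i} → ι i ≡ 0# → i ≡ 0ℤ
  ι≡0⇒≡0ℤ {ℤ.+ zero}  _    = refl
  ι≡0⇒≡0ℤ {+[1+ n ]}  ι≡0 = ⊥-elim (proj₂ (0<ι-suc n) (sym ι≡0))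
  ι≡0⇒≡0ℤ { -[1+ n ]} ι≡0 = ⊥-elim (proj₂ (0<ι-suc n)
    (sym (trans (sym (-‿involutive _)) (trans (cong -_ ι≡0) -0#≈0#))))

module Minkowski (LEM : (P : Set) → Dec P) (F : OrderedField) where
  open OrderedFieldProperties F
  open Space F using (sq; sumSq)

  sq≡0⇒≡0 : ∀ {x} → x * x ≡ 0# → x ≡ 0#
  sq≡0⇒≡0 {x} xx≡0 with LEM (x ≡ 0#)
  ... | yes x≡0 = x≡0
  ... | no  x≢0 = ⊥-elim (proj₂ (0<x*x x≢0) (sym xx≡0))

  sumSq-self : ∀ {m} (xs : Vec Carrier m) → sumSq xs xs ≡ 0#
  sumSq-self []       = refl
  sumSq-self (x ∷ xs) = trans (cong₂ _+_ (solve 1 (λ x → (x :- x) :* (x :- x) := con 0ℤ) refl x) (sumSq-self xs))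
                              (+-identityʳ 0#)

  sumSq-sym : ∀ {m} (xs ys : Vec Carrier m) → sumSq xs ys ≡ sumSq ys xs
  sumSq-sym []       []       = refl
  sumSq-sym (x ∷ xs) (y ∷ ys) =
    cong₂ _+_ (solve 2 (λ x y → (x :- y) :* (x :- y) := (y :- x) :* (y :- x)) refl x y) (sumSq-sym xs ys)

  0≤sumSq : ∀ {m} (xs ys : Vec Carrier m) → 0# ≤ sumSq xs ys
  0≤sumSq []       []       = ≤-refl
  0≤sumSq (x ∷ xs) (y ∷ ys) = +-nonneg (0≤x*x (x - y)) (0≤sumSq xs ys)

  sumSq≡0⇒≡ : ∀ {m} (xs ys : Vec Carrier m) → sumSq xs ys ≡ 0# → xs ≡ ys
  sumSq≡0⇒≡ []       []       _ = refl
  sumSq≡0⇒≡ (x ∷ xs) (y ∷ ys) ≡0 = cong₂ _∷_ (-≡0⇒≡ (sq≡0⇒≡0 head≡0)) (sumSq≡0⇒≡ xs ys tail≡0)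
    where
    head≡0 : sq (x - y) ≡ 0#
    head≡0 = +-nonneg-≡0 (0≤x*x (x - y)) (0≤sumSq xs ys) ≡0
    tail≡0 : sumSq xs ys ≡ 0#
    tail≡0 = +-nonneg-≡0 (0≤sumSq xs ys) (0≤x*x (x - y)) (trans (+-comm _ _) ≡0)

  norm² : ∀ {m} → Vec Carrier m → Carrier
  norm² []       = 0#
  norm² (x ∷ xs) = x * x + norm² xs

  offset : ∀ {m} → Vec Carrier m → Carrier → Vec Carrier m → Vec Carrier m
  offset = λ o c e → zipWith (λ oᵢ eᵢ → oᵢ + c * eᵢ) o e

  offset-zero : ∀ {m} (o e : Vec Carrier m) → offset o 0# e ≡ o
  offset-zero []       []       = refl
  offset-zero (o ∷ os) (e ∷ es) = cong₂ _∷_ (trans (cong (o +_) (zeroˡ e)) (+-identityʳ o)) (offset-zero os es)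

  sumSq-offset : ∀ {m} c d (o e : Vec Carrier m) → sumSq (offset o c e) (offset o d e) ≡ sq (c - d) * norm² e
  sumSq-offset c d []       []       = sym (zeroʳ _)
  sumSq-offset c d (o ∷ os) (e ∷ es) = begin
    sq ((o + c * e) - (o + d * e)) + sumSq (offset os c es) (offset os d es)
      ≡⟨ cong (sq ((o + c * e) - (o + d * e)) +_) (sumSq-offset c d os es) ⟩
    sq ((o + c * e) - (o + d * e)) + sq (c - d) * norm² es
      ≡⟨ solve 5 (λ c d o e N → ((o :+ c :* e) :- (o :+ d :* e)) :* ((o :+ c :* e) :- (o :+ d :* e))
                                 :+ ((c :- d) :* (c :- d)) :* N := ((c :- d) :* (c :- d)) :* (e :* e :+ N))
                refl c d o e (norm² es) ⟩
    sq (c - d) * (e * e + norm² es) ∎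
    where open ≡-Reasoning

  e₁ : ∀ {m} → Vec Carrier (suc m)
  e₁ {m} = 1# ∷ replicate m 0#

  norm²-e₁ : ∀ {m} → norm² (e₁ {m}) ≡ 1#
  norm²-e₁ {m} = trans (cong₂ _+_ (*-identityˡ 1#) (norm²-zeros m)) (+-identityʳ 1#)
    where
    norm²-zeros : ∀ m → norm² (replicate m 0#) ≡ 0#
    norm²-zeros zero    = refl
    norm²-zeros (suc m) = trans (cong₂ _+_ (zeroˡ 0#) (norm²-zeros m)) (+-identityʳ 0#)

  unit-direction : ∀ {m} (p q : Vec Carrier (suc m)) s → s * s ≡ sumSq q p →
                   ∃ λ e → norm² e ≡ 1# × q ≡ offset p s e
  unit-direction {m} p q s ss≡ with LEM (s ≡ 0#)
  ... | yes refl = e₁ , norm²-e₁ {m} , trans (sumSq≡0⇒≡ q p (trans (sym ss≡) (zeroˡ 0#))) (sym (offset-zero p e₁))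
  ... | no  s≢0 with inverse s s≢0
  ...   | s⁻¹ , ss⁻¹≡1 = e , norm²-e , sym (offset-e p q)
    where
    e = zipWith (λ qᵢ pᵢ → (qᵢ - pᵢ) * s⁻¹) q p

    norm²-scaled : ∀ {m} (q p : Vec Carrier m) →
                   norm² (zipWith (λ qᵢ pᵢ → (qᵢ - pᵢ) * s⁻¹) q p) ≡ sumSq q p * (s⁻¹ * s⁻¹)
    norm²-scaled []       []       = sym (zeroˡ _)
    norm²-scaled (q ∷ qs) (p ∷ ps) = trans (cong (((q - p) * s⁻¹) * ((q - p) * s⁻¹) +_) (norm²-scaled qs ps))
      (solve 4 (λ c q p S → ((q :- p) :* c) :* ((q :- p) :* c) :+ S :* (c :* c)
                            := ((q :- p) :* (q :- p) :+ S) :* (c :* c))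
        refl s⁻¹ q p (sumSq qs ps))

    norm²-e : norm² e ≡ 1#
    norm²-e = begin
      norm² e                      ≡⟨ norm²-scaled q p ⟩
      sumSq q p * (s⁻¹ * s⁻¹)      ≡⟨ cong (_* (s⁻¹ * s⁻¹)) ss≡ ⟨
      (s * s) * (s⁻¹ * s⁻¹)        ≡⟨ solve 2 (λ s t → (s :* s) :* (t :* t) := (s :* t) :* (s :* t)) refl s s⁻¹ ⟩
      (s * s⁻¹) * (s * s⁻¹)        ≡⟨ cong₂ _*_ ss⁻¹≡1 ss⁻¹≡1 ⟩
      1# * 1#                      ≡⟨ *-identityˡ 1# ⟩
      1#                           ∎
      where open ≡-Reasoning

    offset-e : ∀ {m} (p q : Vec Carrier m) → offset p s (zipWith (λ qᵢ pᵢ → (qᵢ - pᵢ) * s⁻¹) q p) ≡ q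
    offset-e []       []       = refl
    offset-e (p ∷ ps) (q ∷ qs) = cong₂ _∷_ (begin
      p + s * ((q - p) * s⁻¹)   ≡⟨ solve 4 (λ s t p q → p :+ s :* ((q :- p) :* t) := p :+ (q :- p) :* (s :* t))
                                            refl s s⁻¹ p q ⟩
      p + (q - p) * (s * s⁻¹)   ≡⟨ cong (λ t → p + (q - p) * t) ss⁻¹≡1 ⟩
      p + (q - p) * 1#          ≡⟨ cong (p +_) (*-identityʳ (q - p)) ⟩
      p + (q - p)               ≡⟨ solve 2 (λ p q → p :+ (q :- p) := q) refl p q ⟩
      q                         ∎) (offset-e ps qs)
      where open ≡-Reasoning

  signed : Rho → Carrier → Carrier
  signed rτ x = x
  signed rσ x = - x

  signed-* : ∀ ρ x y → signed ρ (x * y) ≡ signed ρ x * y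
  signed-* rτ x y = refl
  signed-* rσ x y = -‿distribˡ-* x y

  signed-0 : ∀ ρ → signed ρ 0# ≡ 0#
  signed-0 rτ = refl
  signed-0 rσ = -0#≈0#

  signed-neg : ∀ ρ x → signed ρ (- x) ≡ - signed ρ x
  signed-neg rτ x = refl
  signed-neg rσ x = refl

  signed≡0 : ∀ ρ {x} → signed ρ x ≡ 0# → x ≡ 0#
  signed≡0 rτ x≡0 = x≡0
  signed≡0 rσ {x} -x≡0 = trans (sym (-‿involutive x)) (trans (cong -_ -x≡0) -0#≈0#)

  signed-square : ∀ ρ x → signed ρ (x * signed ρ x) ≡ x * x
  signed-square rτ x = refl
  signed-square rσ x = solve 1 (λ x → :- (x :* (:- x)) := x :* x) refl x

  interval : ∀ {m} → Vec Carrier (suc m) → Vec Carrier (suc m) → Carrier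
  interval (p₀ ∷ p) (q₀ ∷ q) = sq (p₀ - q₀) - sumSq p q

  interval-sym : ∀ {m} (p q : Vec Carrier (suc m)) → interval p q ≡ interval q p
  interval-sym (p₀ ∷ p) (q₀ ∷ q) =
    cong₂ _-_ (solve 2 (λ x y → (x :- y) :* (x :- y) := (y :- x) :* (y :- x)) refl p₀ q₀) (sumSq-sym p q)

  interval-self : ∀ {m} (p : Vec Carrier (suc m)) → interval p p ≡ 0#
  interval-self (p₀ ∷ p) = trans (cong₂ _-_ (solve 1 (λ x → (x :- x) :* (x :- x) := con 0ℤ) refl p₀) (sumSq-self p))
                                 (-‿inverseʳ 0#)

  rel⇔0<interval : ∀ {m} ρ {p q : Vec Carrier (suc m)} →
                   Semantics.rel F (suc m) ρ p q ⇔ 0# < signed ρ (interval p q)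
  rel⇔0<interval rτ {_ ∷ _} {_ ∷ _} = <⇔0<-
  rel⇔0<interval rσ {_ ∷ _} {_ ∷ _} = ⇔.trans <⇔0<- (mk⇔ (subst (0# <_) (flip _ _)) (subst (0# <_) (sym (flip _ _))))
    where
    flip : ∀ x y → y - x ≡ - (x - y)
    flip x y = solve 2 (λ x y → y :- x := :- (x :- y)) refl x y

  minkowski : ℕ → Rho → Graph
  minkowski m ρ = record
    { Vertex   = Vec Carrier (suc m)
    ; _~_      = rel
    ; _≟_      = λ p q → LEM (p ≡ q)
    ; _~?_     = λ p q → LEM (rel p q)
    ; ~-irrefl = λ {p} p~p → proj₂ (Equivalence.to (rel⇔0<interval ρ) p~p)
                   (sym (trans (cong (signed ρ) (interval-self p)) (signed-0 ρ)))
    ; ~-sym    = λ {p} {q} p~q → Equivalence.from (rel⇔0<interval ρ)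
                   (subst (λ t → 0# < signed ρ t) (interval-sym p q) (Equivalence.to (rel⇔0<interval ρ) p~q))
    }
    where open Semantics F (suc m) ρ using (rel)

  record Frame (m : ℕ) (ρ : Rho) : Set where
    field
      o₀          : Carrier
      o           : Vec Carrier m
      a b         : Carrier
      e           : Vec Carrier m
      e-unit      : norm² e ≡ 1#
      ab-positive : 0# < signed ρ (a * b)

    H C : Point → Carrier
    H (u , w) = ι u * a + ι w * b
    C (u , w) = ι u * a - ι w * b

    embed : Point → Vec Carrier (suc m)
    embed x = (o₀ + H x) ∷ offset o (C x) e

    sumSq-embed : ∀ x y → sumSq (offset o (C x) e) (offset o (C y) e) ≡ sq (C x - C y)
    sumSq-embed x y = trans (sumSq-offset (C x) (C y) o e) (trans (cong (sq (C x - C y) *_) e-unit) (*-identityʳ _))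

    interval-embed : ∀ x y → interval (embed x) (embed y) ≡ ((a * b) * ι (ℤ.+ 4)) * ι (diffProduct x y)
    interval-embed x@(u , w) y@(u′ , w′) = begin
      sq ((o₀ + H x) - (o₀ + H y)) - sumSq (offset o (C x) e) (offset o (C y) e)
        ≡⟨ cong (λ t → sq ((o₀ + H x) - (o₀ + H y)) - t) (sumSq-embed x y) ⟩
      sq ((o₀ + H x) - (o₀ + H y)) - sq (C x - C y)
        ≡⟨ solve 7 (λ o₀ a b u w u′ w′ →
             ((o₀ :+ (u :* a :+ w :* b)) :- (o₀ :+ (u′ :* a :+ w′ :* b)))
               :* ((o₀ :+ (u :* a :+ w :* b)) :- (o₀ :+ (u′ :* a :+ w′ :* b)))
             :- ((u :* a :- w :* b) :- (u′ :* a :- w′ :* b)) :* ((u :* a :- w :* b) :- (u′ :* a :- w′ :* b))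
             := ((a :* b) :* con (ℤ.+ 4)) :* ((u :- u′) :* (w :- w′)))
           refl o₀ a b (ι u) (ι w) (ι u′) (ι w′) ⟩
      ((a * b) * ι (ℤ.+ 4)) * ((ι u - ι u′) * (ι w - ι w′))
        ≡⟨ cong (((a * b) * ι (ℤ.+ 4)) *_) (trans (ι-* (u ℤ.- u′) (w ℤ.- w′)) (cong₂ _*_ (ι-sub u u′) (ι-sub w w′))) ⟨
      ((a * b) * ι (ℤ.+ 4)) * ι (diffProduct x y) ∎
      where open ≡-Reasoning

    rel-embed : ∀ {x y} → Semantics.rel F (suc m) ρ (embed x) (embed y) ⇔ 0ℤ ℤ.< diffProduct x y
    rel-embed {x} {y} = ⇔.trans (rel⇔0<interval ρ) (⇔.trans
      (mk⇔ (subst (0# <_) rewrite-interval) (subst (0# <_) (sym rewrite-interval)))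
      (⇔.trans (pos*-⇔ (*-pos ab-positive (0<ι-suc 3))) 0<ι⇔))
      where
      rewrite-interval : signed ρ (interval (embed x) (embed y)) ≡ (signed ρ (a * b) * ι (ℤ.+ 4)) * ι (diffProduct x y)
      rewrite-interval = begin
        signed ρ (interval (embed x) (embed y))                  ≡⟨ cong (signed ρ) (interval-embed x y) ⟩
        signed ρ (((a * b) * ι (ℤ.+ 4)) * ι (diffProduct x y))   ≡⟨ signed-* ρ _ _ ⟩
        signed ρ ((a * b) * ι (ℤ.+ 4)) * ι (diffProduct x y)     ≡⟨ cong (_* ι (diffProduct x y)) (signed-* ρ _ _) ⟩
        (signed ρ (a * b) * ι (ℤ.+ 4)) * ι (diffProduct x y)     ∎
        where open ≡-Reasoning

    private
      ≢0-factors : a ≢ 0# × b ≢ 0#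
      ≢0-factors = (λ a≡0 → vanishes (trans (cong (_* b) a≡0) (zeroˡ b)))
                 , (λ b≡0 → vanishes (trans (cong (a *_) b≡0) (zeroʳ a)))
        where
        vanishes : a * b ≡ 0# → ⊥
        vanishes ab≡0 = proj₂ ab-positive (sym (trans (cong (signed ρ) ab≡0) (signed-0 ρ)))

      cancel : ∀ {c} i j → c ≢ 0# → ι (ℤ.+ 2) * (c * (ι i - ι j)) ≡ 0# → i ≡ j
      cancel i j c≢0 ≡0 = ℤ.i-j≡0⇒i≡j i j (ι≡0⇒≡0ℤ (trans (ι-sub i j)
        (*-cancel-≡0 c≢0 (*-cancel-≡0 (λ 2≡0 → proj₂ (0<ι-suc 1) (sym 2≡0)) ≡0))))

    embed-injective : ∀ {x y} → embed x ≡ embed y → x ≡ y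
    embed-injective {u , w} {u′ , w′} embed≡ = cong₂ _,_
      (cancel u u′ (proj₁ ≢0-factors) (trans identity-u (trans (cong₂ _+_ ΔH≡0 ΔC≡0) (+-identityʳ 0#))))
      (cancel w w′ (proj₂ ≢0-factors) (trans identity-w (trans (cong₂ _-_ ΔH≡0 ΔC≡0) (-‿inverseʳ 0#))))
      where
      x y : Point
      x = u , w
      y = u′ , w′

      ΔH≡0 : (o₀ + H x) - (o₀ + H y) ≡ 0#
      ΔH≡0 = trans (cong (λ t → t - (o₀ + H y)) (cong head embed≡)) (-‿inverseʳ _)

      ΔC≡0 : C x - C y ≡ 0#
      ΔC≡0 = sq≡0⇒≡0 (begin
        sq (C x - C y)                               ≡⟨ sumSq-embed x y ⟨
        sumSq (offset o (C x) e) (offset o (C y) e)   ≡⟨ cong (λ t → sumSq t (offset o (C y) e)) (cong tail embed≡) ⟩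
        sumSq (offset o (C y) e) (offset o (C y) e)   ≡⟨ sumSq-self (offset o (C y) e) ⟩
        0#                                           ∎)
        where open ≡-Reasoning

      identity-u : ι (ℤ.+ 2) * (a * (ι u - ι u′)) ≡ ((o₀ + H x) - (o₀ + H y)) + (C x - C y)
      identity-u = solve 7 (λ o₀ a b u w u′ w′ → con (ℤ.+ 2) :* (a :* (u :- u′)) :=
        ((o₀ :+ (u :* a :+ w :* b)) :- (o₀ :+ (u′ :* a :+ w′ :* b))) :+ ((u :* a :- w :* b) :- (u′ :* a :- w′ :* b)))
        refl o₀ a b (ι u) (ι w) (ι u′) (ι w′)

      identity-w : ι (ℤ.+ 2) * (b * (ι w - ι w′)) ≡ ((o₀ + H x) - (o₀ + H y)) - (C x - C y)
      identity-w = solve 7 (λ o₀ a b u w u′ w′ → con (ℤ.+ 2) :* (b :* (w :- w′)) :=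
        ((o₀ :+ (u :* a :+ w :* b)) :- (o₀ :+ (u′ :* a :+ w′ :* b))) :- ((u :* a :- w :* b) :- (u′ :* a :- w′ :* b)))
        refl o₀ a b (ι u) (ι w) (ι u′) (ι w′)

    embedding : comparability ↪ minkowski m ρ
    embedding = record { apply = embed ; injective = embed-injective ; ~-reflect = λ {x} {y} → rel-embed {x} {y} }

    embed-origin : embed origin ≡ o₀ ∷ o
    embed-origin = cong₂ _∷_ (solve 3 (λ o₀ a b → o₀ :+ (con 0ℤ :* a :+ con 0ℤ :* b) := o₀) refl o₀ a b)
      (trans (cong (λ t → offset o t e) (solve 2 (λ a b → con 0ℤ :* a :- con 0ℤ :* b := con 0ℤ) refl a b))
             (offset-zero o e))

    embed-hits : ∀ {x q₀ q s} → H x ≡ q₀ - o₀ → C x ≡ s → q ≡ offset o s e → embed x ≡ q₀ ∷ q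
    embed-hits {x} {q₀} H≡ refl q≡ = cong₂ _∷_
      (trans (cong (o₀ +_) H≡) (solve 2 (λ o₀ q₀ → o₀ :+ (q₀ :- o₀) := q₀) refl o₀ q₀)) (sym q≡)

  HasRoots : ℕ → Set
  HasRoots m = (q p : Vec Carrier m) → ∃ λ s → s * s ≡ sumSq q p

  module _ {k : ℕ} (ρ : Rho) where
    open Semantics F (suc (suc k)) ρ using (rel)

    Hit : Vec Carrier (suc (suc k)) → Vec Carrier (suc (suc k)) → Set
    Hit p q = ∃ λ c → c ∈ canonical × Σ (Frame (suc k) ρ) λ f → Frame.embed f origin ≡ p × Frame.embed f c ≡ q

    hit-via : ∀ {p₀ pt q₀ qt s e} → norm² e ≡ 1# → qt ≡ offset pt s e →
              ∀ {u w} → (u , w) ∈ canonical → ∀ a b → 0# < signed ρ (a * b) →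
              ι u * a + ι w * b ≡ q₀ - p₀ → ι u * a - ι w * b ≡ s → Hit (p₀ ∷ pt) (q₀ ∷ qt)
    hit-via {p₀} {pt} {e = e} unit qt≡ {u} {w} c∈ a b ab-positive H≡ C≡ =
      _ , c∈ , f , Frame.embed-origin f , Frame.embed-hits f {u , w} H≡ C≡ qt≡
      where
      f : Frame (suc k) ρ
      f = record { o₀ = p₀ ; o = pt ; a = a ; b = b ; e = e ; e-unit = unit ; ab-positive = ab-positive }

    private
      quarter : ∃ λ h → ι (ℤ.+ 4) * h ≡ 1#
      quarter = inverse (ι (ℤ.+ 4)) (λ 4≡0 → proj₂ (0<ι-suc 3) (sym 4≡0))

      scaled-positive : ∀ {x} h → h ≢ 0# → 0# < signed ρ x → 0# < signed ρ (x * (h * h))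
      scaled-positive {x} h h≢0 0<x = subst (0# <_) (sym (signed-* ρ x (h * h))) (*-pos 0<x (0<x*x h≢0))

      quarter-≢0 : ∀ {h} → ι (ℤ.+ 4) * h ≡ 1# → h ≢ 0#
      quarter-≢0 {h} 4h≡1 h≡0 = 0≢1 (trans (sym (zeroʳ _)) (trans (cong (ι (ℤ.+ 4) *_) (sym h≡0)) 4h≡1))

      interval≡ : ∀ {p₀ q₀ s} {pt qt : Vec Carrier (suc k)} → s * s ≡ sumSq qt pt →
                  interval (p₀ ∷ pt) (q₀ ∷ qt) ≡ (q₀ - p₀) * (q₀ - p₀) - s * s
      interval≡ {p₀} {q₀} {pt = pt} {qt} ss≡ = cong₂ _-_
        (solve 2 (λ p q → (p :- q) :* (p :- q) := (q :- p) :* (q :- p)) refl p₀ q₀)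
        (trans (sumSq-sym pt qt) (sym ss≡))

      four-h : ∀ {h} x → ι (ℤ.+ 4) * h ≡ 1# → (ι (ℤ.+ 4) * h) * x ≡ x
      four-h x 4h≡1 = trans (cong (_* x) 4h≡1) (*-identityˡ x)

    hit-same : ∀ {p q} → p ≡ q → Hit p q
    hit-same {p₀ ∷ pt} refl = hit-via (norm²-e₁ {k}) (sym (offset-zero pt e₁)) (here refl) 1# (signed ρ 1#)
      (subst (0# <_) (sym (signed-square ρ 1#)) (0<x*x (λ 1≡0 → 0≢1 (sym 1≡0))))
      (solve 3 (λ one b p → con 0ℤ :* one :+ con 0ℤ :* b := p :- p) refl 1# (signed ρ 1#) p₀)
      (solve 2 (λ one b → con 0ℤ :* one :- con 0ℤ :* b := con 0ℤ) refl 1# (signed ρ 1#))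

    hit-lightlike : ∀ {p₀ pt q₀ qt} → p₀ ∷ pt ≢ q₀ ∷ qt → (q₀ - p₀) * (q₀ - p₀) ≡ sumSq qt pt →
                    Hit (p₀ ∷ pt) (q₀ ∷ qt)
    hit-lightlike {p₀} {pt} {q₀} {qt} p≢q light with unit-direction pt qt (q₀ - p₀) light | quarter
    ... | e , unit , qt≡ | h , 4h≡1 = hit-via unit qt≡ (there (there (here refl))) a b 0<ab H≡ C≡
      where
      v = q₀ - p₀
      a = (ι (ℤ.+ 2) * h) * v
      b = signed ρ a

      v≢0 : v ≢ 0#
      v≢0 v≡0 = p≢q (sym (cong₂ _∷_ (-≡0⇒≡ v≡0)
        (sumSq≡0⇒≡ qt pt (trans (sym light) (trans (cong (λ t → t * t) v≡0) (zeroˡ 0#))))))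

      0<ab : 0# < signed ρ (a * b)
      0<ab = subst (0# <_) (sym (signed-square ρ a)) (0<x*x λ a≡0 → v≢0 (*-cancel-≡0 2h≢0 a≡0))
        where
        2h≢0 : ι (ℤ.+ 2) * h ≢ 0#
        2h≢0 2h≡0 = quarter-≢0 4h≡1 (*-cancel-≡0 (λ 2≡0 → proj₂ (0<ι-suc 1) (sym 2≡0)) 2h≡0)

      H≡ : ι (ℤ.+ 2) * a + ι 0ℤ * b ≡ v
      H≡ = trans (solve 3 (λ h v b → con (ℤ.+ 2) :* ((con (ℤ.+ 2) :* h) :* v) :+ con 0ℤ :* b
                                      := (con (ℤ.+ 4) :* h) :* v) refl h v b)
                 (four-h v 4h≡1)

      C≡ : ι (ℤ.+ 2) * a - ι 0ℤ * b ≡ v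
      C≡ = trans (solve 3 (λ h v b → con (ℤ.+ 2) :* ((con (ℤ.+ 2) :* h) :* v) :- con 0ℤ :* b
                                      := (con (ℤ.+ 4) :* h) :* v) refl h v b)
                 (four-h v 4h≡1)

    hit-related : HasRoots (suc k) → ∀ {p₀ pt q₀ qt} → rel (p₀ ∷ pt) (q₀ ∷ qt) → Hit (p₀ ∷ pt) (q₀ ∷ qt)
    hit-related roots {p₀} {pt} {q₀} {qt} p~q with roots qt pt | quarter
    ... | s , ss≡ | h , 4h≡1 with unit-direction pt qt s ss≡
    ...   | e , unit , qt≡ = hit-via unit qt≡ (there (here refl)) a b 0<ab H≡ C≡
      where
      v = q₀ - p₀
      a = (v + s) * h
      b = (v - s) * h

      0<ab : 0# < signed ρ (a * b)
      0<ab = subst (λ t → 0# < signed ρ t) ab≡ (scaled-positive h (quarter-≢0 4h≡1)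
        (subst (λ t → 0# < signed ρ t) (interval≡ {p₀} {q₀} {pt = pt} {qt} ss≡)
          (Equivalence.to (rel⇔0<interval ρ) p~q)))
        where
        ab≡ : (v * v - s * s) * (h * h) ≡ a * b
        ab≡ = solve 3 (λ v s h → (v :* v :- s :* s) :* (h :* h) := ((v :+ s) :* h) :* ((v :- s) :* h)) refl v s h

      H≡ : ι (ℤ.+ 2) * a + ι (ℤ.+ 2) * b ≡ v
      H≡ = trans (solve 3 (λ v s h → con (ℤ.+ 2) :* ((v :+ s) :* h) :+ con (ℤ.+ 2) :* ((v :- s) :* h)
                                      := (con (ℤ.+ 4) :* h) :* v) refl v s h)
                 (four-h v 4h≡1)

      C≡ : ι (ℤ.+ 2) * a - ι (ℤ.+ 2) * b ≡ s
      C≡ = trans (solve 3 (λ v s h → con (ℤ.+ 2) :* ((v :+ s) :* h) :- con (ℤ.+ 2) :* ((v :- s) :* h)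
                                      := (con (ℤ.+ 4) :* h) :* s) refl v s h)
                 (four-h s 4h≡1)

    hit-apart : HasRoots (suc k) → ∀ {p₀ pt q₀ qt} → ¬ rel (p₀ ∷ pt) (q₀ ∷ qt) →
                (q₀ - p₀) * (q₀ - p₀) ≢ sumSq qt pt → Hit (p₀ ∷ pt) (q₀ ∷ qt)
    hit-apart roots {p₀} {pt} {q₀} {qt} p≁q not-light with roots qt pt | quarter
    ... | s , ss≡ | h , 4h≡1 with unit-direction pt qt s ss≡
    ...   | e , unit , qt≡ = hit-via unit qt≡ (there (there (there (here refl)))) a b 0<ab H≡ C≡
      where
      v = q₀ - p₀
      a = (v + s) * h
      b = (s - v) * h
      I = v * v - s * s

      0≮I : ¬ 0# < signed ρ I
      0≮I 0<I = p≁q (Equivalence.from (rel⇔0<interval ρ)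
        (subst (λ t → 0# < signed ρ t) (sym (interval≡ {p₀} {q₀} {pt = pt} {qt} ss≡)) 0<I))

      signed-I≢0 : signed ρ I ≢ 0#
      signed-I≢0 I≡0 = not-light (trans (-≡0⇒≡ (signed≡0 ρ I≡0)) ss≡)

      0<ab : 0# < signed ρ (a * b)
      0<ab = subst (λ t → 0# < signed ρ t) ab≡ (scaled-positive h (quarter-≢0 4h≡1)
        (subst (0# <_) (sym (signed-neg ρ I)) (0≮⇒0<- 0≮I signed-I≢0)))
        where
        ab≡ : (- I) * (h * h) ≡ a * b
        ab≡ = solve 3 (λ v s h → (:- (v :* v :- s :* s)) :* (h :* h) := ((v :+ s) :* h) :* ((s :- v) :* h)) refl v s h

      H≡ : ι (ℤ.+ 2) * a + ι (ℤ.- ℤ.+ 2) * b ≡ v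
      H≡ = trans (solve 3 (λ v s h → con (ℤ.+ 2) :* ((v :+ s) :* h) :+ con (ℤ.- ℤ.+ 2) :* ((s :- v) :* h)
                                      := (con (ℤ.+ 4) :* h) :* v) refl v s h)
                 (four-h v 4h≡1)

      C≡ : ι (ℤ.+ 2) * a - ι (ℤ.- ℤ.+ 2) * b ≡ s
      C≡ = trans (solve 3 (λ v s h → con (ℤ.+ 2) :* ((v :+ s) :* h) :- con (ℤ.- ℤ.+ 2) :* ((s :- v) :* h)
                                      := (con (ℤ.+ 4) :* h) :* s) refl v s h)
                 (four-h s 4h≡1)

    every-pair-hit : HasRoots (suc k) → ∀ p q → Hit p q
    every-pair-hit roots p@(p₀ ∷ pt) q@(q₀ ∷ qt)
      with LEM (p ≡ q) | LEM (rel p q) | LEM ((q₀ - p₀) * (q₀ - p₀) ≡ sumSq qt pt)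
    ... | yes p≡q | _       | _         = hit-same p≡q
    ... | no _    | yes p~q | _         = hit-related roots p~q
    ... | no p≢q  | no _    | yes light = hit-lightlike p≢q light
    ... | no _    | no p≁q  | no ¬light = hit-apart roots p≁q ¬light

module Definability (LEM : (P : Set) → Dec P) (F : OrderedField) (k : ℕ) (ρ : Rho)
                    (roots : Minkowski.HasRoots LEM F (suc k)) where
  open Minkowski LEM F using (minkowski; module Frame; every-pair-hit)
  open Semantics F (suc (suc k)) ρ
  open Graph (minkowski (suc k) ρ) using (typeOf; diagram; typeOf≡same⇔; typeOf≡related⇔; typeOf≡apart⇔;
                                            diagram-consistent; diagram≗fromLabels)

  private
    ≡-⇔ : ∀ {a b t : PairType} → a ≡ b → (a ≡ t ⇔ b ≡ t)
    ≡-⇔ a≡b = mk⇔ (trans (sym a≡b)) (trans a≡b)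

  ⟦⟧-cong : ∀ {j} (ψ : QF j) {v v′ : Fin j → Pt} → (∀ i i′ → diagram v i i′ ≡ diagram v′ i i′) → ⟦ ψ ⟧ v ⇔ ⟦ ψ ⟧ v′
  ⟦⟧-cong (eqA i i′)  D≡ = ⇔.trans (⇔.sym typeOf≡same⇔) (⇔.trans (≡-⇔ (D≡ i i′)) typeOf≡same⇔)
  ⟦⟧-cong (relA i i′) D≡ = ⇔.trans (⇔.sym typeOf≡related⇔) (⇔.trans (≡-⇔ (D≡ i i′)) typeOf≡related⇔)
  ⟦⟧-cong (neg ψ)     D≡ = ¬-cong-⇔ (⟦⟧-cong ψ D≡)
  ⟦⟧-cong (and ψ φ)   D≡ = ⟦⟧-cong ψ D≡ ×-⇔ ⟦⟧-cong φ D≡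
  ⟦⟧-cong (or ψ φ)    D≡ = ⟦⟧-cong ψ D≡ ⊎-⇔ ⟦⟧-cong φ D≡

  extend-via : ∀ {p q p′ q′} → Minkowski.Hit LEM F ρ p′ q′ → typeOf p q ≡ typeOf p′ q′ → ∀ z₁ z₂ →
               ∃₂ λ z₁′ z₂′ → ∀ i j → diagram (env4 p q z₁ z₂) i j ≡ diagram (env4 p′ q′ z₁′ z₂′) i j
  extend-via {p} {q} {p′} {q′} (c , c∈ , f , f-origin , f-c) type≡ z₁ z₂ =
    realize (All.lookup canonical-extendable c∈ (upper D) base-type consistent)
    where
    open _↪_ (Frame.embedding f)
    D = diagram (env4 p q z₁ z₂)
    base-type : typeOf p q ≡ typeℤ² origin c
    base-type = trans type≡ (trans (cong₂ typeOf (sym f-origin) (sym f-c)) (typeOf-apply origin c))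
    consistent : Consistent (fromLabels (upper D))
    consistent = Consistent-resp (diagram≗fromLabels (env4 p q z₁ z₂)) (diagram-consistent (env4 p q z₁ z₂))
    realize : ∃₂ (λ x₁ x₂ → upper (diagramℤ² (quad origin c x₁ x₂)) ≡ upper D) →
              ∃₂ λ z₁′ z₂′ → ∀ i j → D i j ≡ diagram (env4 p′ q′ z₁′ z₂′) i j
    realize (x₁ , x₂ , upper≡) = apply x₁ , apply x₂ , λ i j → begin
      D i j                                          ≡⟨ diagram≗fromLabels (env4 p q z₁ z₂) i j ⟩
      fromLabels (upper D) i j                       ≡⟨ cong (λ L → fromLabels L i j) upper≡ ⟨
      fromLabels (upper (diagramℤ² xs)) i j          ≡⟨ Graph.diagram≗fromLabels comparability xs i j ⟨
      diagramℤ² xs i j                               ≡⟨ typeOf-apply (xs i) (xs j) ⟨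
      typeOf (apply (xs i)) (apply (xs j))           ≡⟨ cong₂ typeOf (apply-xs i) (apply-xs j) ⟩
      diagram (env4 p′ q′ (apply x₁) (apply x₂)) i j ∎
      where
      open ≡-Reasoning
      xs = quad origin c x₁ x₂
      apply-xs : ∀ i → apply (xs i) ≡ env4 p′ q′ (apply x₁) (apply x₂) i
      apply-xs 0F = f-origin
      apply-xs 1F = f-c
      apply-xs 2F = refl
      apply-xs 3F = refl

  extend : ∀ {p q p′ q′} → typeOf p q ≡ typeOf p′ q′ → ∀ z₁ z₂ →
           ∃₂ λ z₁′ z₂′ → ∀ i j → diagram (env4 p q z₁ z₂) i j ≡ diagram (env4 p′ q′ z₁′ z₂′) i j
  extend {p′ = p′} {q′} = extend-via (every-pair-hit ρ roots p′ q′)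

  ⟦⟧-extend : ∀ {p q p′ q′} (ψ : QF 4) → typeOf p q ≡ typeOf p′ q′ → ∀ z₁ z₂ →
              ∃₂ λ z₁′ z₂′ → ⟦ ψ ⟧ (env4 p q z₁ z₂) ⇔ ⟦ ψ ⟧ (env4 p′ q′ z₁′ z₂′)
  ⟦⟧-extend ψ type≡ z₁ z₂ = map₂ (map₂ (⟦⟧-cong ψ)) (extend type≡ z₁ z₂)

  falsum : QF 2
  falsum = neg (eqA 0F 0F)

  isType : PairType → QF 2
  isType same    = eqA 0F 1F
  isType related = relA 0F 1F
  isType apart   = and (neg (eqA 0F 1F)) (neg (relA 0F 1F))

  ⟦isType⟧⇔ : ∀ t {p q} → ⟦ isType t ⟧ (env2 p q) ⇔ typeOf p q ≡ t
  ⟦isType⟧⇔ same    = ⇔.sym typeOf≡same⇔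
  ⟦isType⟧⇔ related = ⇔.sym typeOf≡related⇔
  ⟦isType⟧⇔ apart   = ⇔.sym typeOf≡apart⇔

  guarded : ∀ {A : Set} → Dec A → QF 2 → QF 2
  guarded (yes _) φ = φ
  guarded (no _)  _ = falsum

  ⟦guarded⟧⇔ : ∀ {A : Set} (a? : Dec A) φ {v} → ⟦ guarded a? φ ⟧ v ⇔ (A × ⟦ φ ⟧ v)
  ⟦guarded⟧⇔ (yes a) φ = mk⇔ (a ,_) proj₂
  ⟦guarded⟧⇔ (no ¬a) φ = mk⇔ (λ ¬refl → ⊥-elim (¬refl refl)) (λ (a , _) → ⊥-elim (¬a a))

  module _ {R : Pt → Pt → Set} where

    invariant : ExistDefinable2 R ⊎ UnivDefinable2 R →
                ∀ {p q p′ q′} → typeOf p q ≡ typeOf p′ q′ → R p q → R p′ q′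
    invariant (inj₁ (ψ , def)) {p} {q} {p′} {q′} type≡ Rpq =
      let z₁ , z₂ , holds = Equivalence.to (def p q) Rpq
          z₁′ , z₂′ , ψ⇔ = ⟦⟧-extend ψ type≡ z₁ z₂
      in Equivalence.from (def p′ q′) (z₁′ , z₂′ , Equivalence.to ψ⇔ holds)
    invariant (inj₂ (ψ , def)) {p} {q} {p′} {q′} type≡ Rpq = Equivalence.from (def p′ q′) λ z₁′ z₂′ →
      let z₁ , z₂ , ψ⇔ = ⟦⟧-extend ψ (sym type≡) z₁′ z₂′
      in Equivalence.from ψ⇔ (Equivalence.to (def p q) Rpq z₁ z₂)

    Occurs : PairType → Set
    Occurs t = ∃₂ λ p q → typeOf p q ≡ t × R p q

    clause : PairType → QF 2
    clause t = guarded (LEM (Occurs t)) (isType t)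

    definition : QF 2
    definition = or (clause same) (or (clause related) (clause apart))

    qf-definable : ExistDefinable2 R ⊎ UnivDefinable2 R → QFDefinable R
    qf-definable D = definition , λ p q → mk⇔ (to p q) (from p q)
      where
      holds : ∀ {p q} t → Occurs t → typeOf p q ≡ t → ⟦ clause t ⟧ (env2 p q)
      holds t occurs type≡ =
        Equivalence.from (⟦guarded⟧⇔ (LEM (Occurs t)) (isType t)) (occurs , Equivalence.from (⟦isType⟧⇔ t) type≡)

      sound : ∀ {p q} t → ⟦ clause t ⟧ (env2 p q) → R p q
      sound t h with Equivalence.to (⟦guarded⟧⇔ (LEM (Occurs t)) (isType t)) h
      ... | (p′ , q′ , type′≡ , Rp′q′) , holds =
        invariant D (trans type′≡ (sym (Equivalence.to (⟦isType⟧⇔ t) holds))) Rp′q′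

      to : ∀ p q → R p q → ⟦ definition ⟧ (env2 p q)
      to p q Rpq with typeOf p q in type≡
      ... | same    = inj₁ (holds same (p , q , type≡ , Rpq) type≡)
      ... | related = inj₂ (inj₁ (holds related (p , q , type≡ , Rpq) type≡))
      ... | apart   = inj₂ (inj₂ (holds apart (p , q , type≡ , Rpq) type≡))

      from : ∀ p q → ⟦ definition ⟧ (env2 p q) → R p q
      from p q (inj₁ h)        = sound same h
      from p q (inj₂ (inj₁ h)) = sound related h
      from p q (inj₂ (inj₂ h)) = sound apart h

open import Data.Nat using (_≤_; s≤s; z≤n)

hasRoots : ∀ LEM F k → (suc (suc k) ≡ 2 ⊎ Euclidean F) → Minkowski.HasRoots LEM F (suc k)
hasRoots LEM F .zero (inj₁ refl) (q ∷ []) (p ∷ []) = q - p , sym (+-identityʳ _)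
  where open OrderedFieldProperties F
hasRoots LEM F k (inj₂ euclidean) q p = euclidean (Space.sumSq F q p) (Minkowski.0≤sumSq LEM F q p)

theorem4p6 : (LEM : (P : Set) → Dec P) → (F : OrderedField) → (n : ℕ) → 2 ≤ n →
    (n ≡ 2 ⊎ Euclidean F) → (ρ : Rho) →
    (R : Vec (OrderedField.Carrier F) n → Vec (OrderedField.Carrier F) n → Set) →
    (Semantics.ExistDefinable2 F n ρ R ⊎ Semantics.UnivDefinable2 F n ρ R) →
    Semantics.QFDefinable F n ρ R
theorem4p6 LEM F (suc (suc k)) (s≤s (s≤s z≤n)) n≡2⊎euclidean ρ R =
  Definability.qf-definable LEM F k ρ (hasRoots LEM F k n≡2⊎euclidean)
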